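{- Fix an integer $b>4$. Consider a relaxed B-slack tree that results from performing a sequence of operations (insertions, deletions, and rebalancing steps applied only when their preconditions hold), $i$ of which are insertions, on a B-slack tree containing $n$ keys. Then the relaxed height of the root, and hence of every node, in this relaxed B-slack tree is at most $\big\lfloor \log_{\lfloor b/2\rfloor}\frac{n+i}{2}\big\rfloor+1$.
   Context: Trees are leaf-oriented search trees with maximum degree $b$: keys are stored in leaves; internal nodes hold child pointers and routing keys. Degree of an internal node = number of non-nil child pointers; degree of a leaf = number of keys; a node of degree $b-x$ contains $x$ slack. Each node has a weight in $\{0,1\}$. Relaxed depth of a node = (sum of weights on the root-to-node path, inclusive) $-1$. A relaxed B-slack tree satisfies: weight-zero nodes have exactly two child pointers; all leaves have equal relaxed depth; internal nodes have $1$ to $b$ pointers; leaves have $0$ to $b$ keys. The relaxed height of a node $u$ is the relaxed depth of the leaves in the tree obtained by detaching the subtree rooted at $u$ (with $u$ as its root). Violations: weight violation = node of weight zero; degree violation = internal node with one child; slack violation = internal node whose children have total slack $\ge b$. A B-slack tree is a relaxed B-slack tree without violations (all weights one, equal leaf depths, internal nodes with $2$ to $b$ pointers, leaves with $0$ to $b$ keys, children of every internal node with total slack $\le b-1$). $\pi(u)$ is the parent of $u$; leaves always have weight one. Operations: deletion removes a key from its leaf; insertion into leaf $u$ adds the key if $u$ has fewer than $b$ keys, otherwise replaces $u$ by a new weight-zero internal node with two weight-one leaf children evenly sharing the $b+1$ keys. Rebalancing steps: Root-Replace (root with one child $u$ removed; $u$ becomes root with weight one); Root-Zero (weight-zero root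 without degree violation gets weight one); Absorb (non-root weight-zero $u$ whose parent has $<b$ pointers: $u$'s two pointers replace the pointer to $u$ in $\pi(u)$, $u$ removed); Split (non-root weight-zero $u$ whose parent has exactly $b$ pointers: the $b+1$ pointers of $\pi(u)$ other than to $u$ plus $u$'s two are evenly distributed in order between $u$ and a new node $v$; $\pi(u)$ gets children $u,v$ only; $u,v$ weight one, $\pi(u)$ weight zero); Compress (internal $u$ with a slack violation, no degree violation, no weight violation at $u$ or its $k\ge2$ children: the $c$ pointers/keys of the children are evenly distributed among the first $\lceil c/b\rceil$ children, the rest removed); One-Child (internal $u$ with a degree violation, no weight violation at $u$ or its siblings, no violation at $\pi(u)$: the pointers/keys of the children of $\pi(u)$ are evenly redistributed among them). -}

module Defs where

open import Data.Nat using (ℕ; zero; suc; _+_; _*_; _∸_; _^_; _≤_; _<_; ⌊_/2⌋)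
open import Data.Bool using (Bool; true; false)
open import Data.List using (List; []; _∷_; _++_; length; map; concat)
open import Data.Nat.ListAction using (sum)
open import Data.List.Relation.Unary.All using (All)
open import Data.List.Relation.Unary.Any using (Any)
open import Data.List.Membership.Propositional using (_∈_)
open import Data.Product using (_×_; ∃; ∃-syntax; _,_)
open import Relation.Binary.PropositionalEquality using (_≡_)
open import Relation.Nullary using (¬_)

Key : Set
Key = ℕ

-- Node weights (only internal nodes carry a weight; leaves always have
-- weight one).
data Wt : Set where
  w0 w1 : Wt

wt : Wt → ℕ
wt w0 = 0
wt w1 = 1

-- A leaf stores its list of keys (in order); an internal node stores its
-- weight and its (non-nil) child pointers, in order.  Routing keys are
-- not modelled.
data Tree : Set where
  leaf : List Key → Tree
  node : Wt → List Tree → Tree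

degree : Tree → ℕ
degree (leaf ks)  = length ks
degree (node _ ts) = length ts

slack : ℕ → Tree → ℕ
slack b t = b ∸ degree t

totalSlack : ℕ → List Tree → ℕ
totalSlack b ts = sum (map (slack b) ts)

mutual
  keysOf : Tree → List Key
  keysOf (leaf ks)   = ks
  keysOf (node _ ts) = keysOfs ts

  keysOfs : List Tree → List Key
  keysOfs []       = []
  keysOfs (t ∷ ts) = keysOf t ++ keysOfs ts

numKeys : Tree → ℕ
numKeys t = length (keysOf t)

data _⊑_ : Tree → Tree → Set where
  here  : ∀ {t} → t ⊑ t
  there : ∀ {u c w ts} → u ⊑ c → c ∈ ts → u ⊑ node w ts

Every : (Tree → Set) → Tree → Set
Every P t = ∀ u → u ⊑ t → P u

data Uniform : Tree → ℕ → Set where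
  leafU : ∀ {ks} → Uniform (leaf ks) 1
  nodeU : ∀ {w ts s} → All (λ t → Uniform t s) ts → Uniform (node w ts) (wt w + s)

leftmostWeight : Tree → ℕ
leftmostWeight (leaf _)          = 1
leftmostWeight (node w [])       = wt w
leftmostWeight (node w (t ∷ _))  = wt w + leftmostWeight t

-- In a relaxed B-slack tree all leaves have the same relaxed depth, so the
-- leftmost path may be used.
relaxedHeight : Tree → ℕ
relaxedHeight t = leftmostWeight t ∸ 1

RelaxedNodeOK : ℕ → Tree → Set
RelaxedNodeOK b (leaf ks)   = length ks ≤ b
RelaxedNodeOK b (node w ts) =
  (1 ≤ length ts) × (length ts ≤ b) × (w ≡ w0 → length ts ≡ 2)

RelaxedBSlack : ℕ → Tree → Set
RelaxedBSlack b t = Every (RelaxedNodeOK b) t × ∃[ s ] Uniform t s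

BSlackNodeOK : ℕ → Tree → Set
BSlackNodeOK b (leaf ks)   = length ks ≤ b
BSlackNodeOK b (node w ts) =
  (w ≡ w1) × (2 ≤ length ts) × (length ts ≤ b) × (totalSlack b ts ≤ b ∸ 1)

BSlack : ℕ → Tree → Set
BSlack b t = Every (BSlackNodeOK b) t × ∃[ s ] Uniform t s

Balanced : {A : Set} → List (List A) → Set
Balanced ps = All (λ p → All (λ q → length p ≤ suc (length q)) ps) ps

EvenSplit : {A : Set} → List A → ℕ → List (List A) → Set
EvenSplit xs m ps = (concat ps ≡ xs) × (length ps ≡ m) × Balanced ps

-- m = ⌈ c / b ⌉  (for b ≥ 1), written out
IsCeilDiv : ℕ → ℕ → ℕ → Set
IsCeilDiv c b m = (c ≤ m * b) × (m * b < c + b)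

data Local (b : ℕ) : Bool → Tree → Tree → Set where
  delete : ∀ pre k post →
    Local b false (leaf (pre ++ k ∷ post)) (leaf (pre ++ post))
  insertSimple : ∀ pre k post →
    length (pre ++ post) < b →
    Local b true (leaf (pre ++ post)) (leaf (pre ++ k ∷ post))
  insertSplit : ∀ pre k post ps qs →
    length (pre ++ post) ≡ b →
    EvenSplit (pre ++ k ∷ post) 2 (ps ∷ qs ∷ []) →
    Local b true (leaf (pre ++ post)) (node w0 (leaf ps ∷ leaf qs ∷ []))
  absorb : ∀ w pre x y post →
    length (pre ++ node w0 (x ∷ y ∷ []) ∷ post) < b →
    Local b false (node w (pre ++ node w0 (x ∷ y ∷ []) ∷ post))
                  (node w (pre ++ x ∷ y ∷ post))
  split : ∀ w pre x y post ps qs →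
    length (pre ++ node w0 (x ∷ y ∷ []) ∷ post) ≡ b →
    EvenSplit (pre ++ x ∷ y ∷ post) 2 (ps ∷ qs ∷ []) →
    Local b false (node w (pre ++ node w0 (x ∷ y ∷ []) ∷ post))
                  (node w0 (node w1 ps ∷ node w1 qs ∷ []))
  compressLeaves : ∀ kss m ps →
    2 ≤ length kss →
    b ≤ totalSlack b (map leaf kss) →
    IsCeilDiv (length (concat kss)) b m →
    EvenSplit (concat kss) m ps →
    Local b false (node w1 (map leaf kss)) (node w1 (map leaf ps))
  compressNodes : ∀ tss m ps →
    2 ≤ length tss →
    b ≤ totalSlack b (map (node w1) tss) →
    IsCeilDiv (length (concat tss)) b m →
    EvenSplit (concat tss) m ps →
    Local b false (node w1 (map (node w1) tss)) (node w1 (map (node w1) ps))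
  oneChild : ∀ tss ps →
    Any (λ cs → length cs ≡ 1) tss →
    2 ≤ length tss →
    totalSlack b (map (node w1) tss) < b →
    EvenSplit (concat tss) (length tss) ps →
    Local b false (node w1 (map (node w1) tss)) (node w1 (map (node w1) ps))

data Deep (b : ℕ) (ins : Bool) : Tree → Tree → Set where
  atNode : ∀ {t t'} → Local b ins t t' → Deep b ins t t'
  inside : ∀ {w pre t t' post} → Deep b ins t t' →
    Deep b ins (node w (pre ++ t ∷ post)) (node w (pre ++ t' ∷ post))

data RootStep : Tree → Tree → Set where
  rootReplaceLeaf : ∀ w ks → RootStep (node w (leaf ks ∷ [])) (leaf ks)
  rootReplaceNode : ∀ w w' ts →
    RootStep (node w (node w' ts ∷ [])) (node w1 ts)
  rootZero : ∀ ts → ¬ (length ts ≡ 1) → RootStep (node w0 ts) (node w1 ts)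

data Step (b : ℕ) : Bool → Tree → Tree → Set where
  deep : ∀ {ins t t'} → Deep b ins t t' → Step b ins t t'
  root : ∀ {t t'} → RootStep t t' → Step b false t t'

ifIns : Bool → ℕ
ifIns true  = 1
ifIns false = 0

data Reach (b : ℕ) : Tree → ℕ → Tree → Set where
  done : ∀ {t} → Reach b t 0 t
  step : ∀ {t ins t' i t''} →
    RelaxedBSlack b t → Step b ins t t' → Reach b t' i t'' →
    Reach b t (ifIns ins + i) t''

-- The bound  h ≤ ⌊ log_k ((n+i)/2) ⌋ + 1  for natural h, k ≥ 2:
-- for h ≥ 1 it says k^(h-1) ≤ (n+i)/2, i.e. 2·k^(h-1) ≤ n+i; for h = 0 it
-- holds (whenever the logarithm is defined, i.e. n+i ≥ 1).

HeightBound : (k x h : ℕ) → Set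
HeightBound k x h = 1 ≤ h → 2 * k ^ (h ∸ 1) ≤ x

-- Let k = ⌊b/2⌋ and give every node of relaxed height h a value: the total value of its children
-- (a key being worth one), raised to at least k^h when the node has weight one; at the root use
-- 2·k^(h-1) instead of k^h. Insertions raise the root value by at most one and no other step
-- raises it: a split or a redistribution either leaves a single node or creates weight-one nodes
-- with at least k children of equal height, which already meet their floor. The root value of a
-- B-slack tree is at most its number of keys, since a weight-one node of height h has at least
-- k^h keys below it, and a relaxed tree whose root has relaxed height h ≥ 1 has root value at
-- least 2·k^(h-1) (a weight-zero root has two children worth k^h each). Hence 2·k^(h-1) ≤ n + i.
module Submission where

open import Defs
open import Data.Nat using (ℕ; _<_; ⌊_/2⌋; _+_)
open import Relation.Binary.PropositionalEquality using (_≡_)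
open import Data.Nat
  using (zero; suc; _*_; _∸_; _^_; _≤_; z≤n; s≤s; _⊔_; ⌈_/2⌉; NonZero; >-nonZero; >-nonZero⁻¹)
open import Data.Nat.Properties
open import Data.Nat.ListAction using (sum)
open import Algebra.Properties.CommutativeSemigroup +-commutativeSemigroup
  using (interchange; xy∙z≈xz∙y)
open import Data.List using (List; []; _∷_; _++_; length; map; concat)
open import Data.List.Properties using (length-++; length-++-sucʳ; length-map; map-∘)
open import Data.List.Relation.Unary.All as All using (All; []; _∷_)
import Data.List.Relation.Unary.All.Properties as All
open import Data.List.Membership.Propositional using (_∈_)
open import Data.List.Membership.Propositional.Properties using (∈-++⁺ʳ)
open import Data.List.Relation.Unary.Any using (here)
open import Data.Empty using (⊥-elim)
open import Data.Product using (_×_; _,_; proj₁; proj₂; ∃-syntax)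
open import Data.Unit using (⊤; tt)
open import Relation.Binary.PropositionalEquality
  using (_≢_; refl; sym; trans; cong; cong₂; subst; subst₂; module ≡-Reasoning)

length-concat : ∀ {A : Set} (xss : List (List A)) → length (concat xss) ≡ sum (map length xss)
length-concat []         = refl
length-concat (xs ∷ xss) = trans (length-++ xs) (cong (length xs +_) (length-concat xss))

length-concat-≤ : ∀ {A : Set} {c} (xss : List (List A)) → All (λ xs → length xs ≤ c) xss →
                  length (concat xss) ≤ length xss * c
length-concat-≤ []         []       = z≤n
length-concat-≤ (xs ∷ xss) (h ∷ hs) =
  ≤-trans (≤-reflexive (length-++ xs)) (+-mono-≤ h (length-concat-≤ xss hs))

sum-map-⊔-≥ : ∀ a ns → sum ns ≤ sum (map (a ⊔_) ns)
sum-map-⊔-≥ a []       = z≤n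
sum-map-⊔-≥ a (n ∷ ns) = +-mono-≤ (m≤n⊔m a n) (sum-map-⊔-≥ a ns)

sum-map-⊔-≡ : ∀ {a} ns → All (a ≤_) ns → sum (map (a ⊔_) ns) ≡ sum ns
sum-map-⊔-≡ []       []       = refl
sum-map-⊔-≡ (n ∷ ns) (h ∷ hs) = cong₂ _+_ (m≤n⇒m⊔n≡n h) (sum-map-⊔-≡ ns hs)

sum-map-⊔-rebalance : ∀ a ms ns → sum ms ≡ sum ns → 1 ≤ length ns →
                      (2 ≤ length ms → All (a ≤_) ms) → sum (map (a ⊔_) ms) ≤ sum (map (a ⊔_) ns)
sum-map-⊔-rebalance a []            ns       _  _ _ = z≤n
sum-map-⊔-rebalance a (m ∷ [])      (n ∷ ns) eq _ _ = begin
  a ⊔ m + 0                  ≡⟨ +-identityʳ (a ⊔ m) ⟩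
  a ⊔ m                      ≤⟨ ⊔-lub a≤ m≤ ⟩
  sum (map (a ⊔_) (n ∷ ns))  ∎
  where
  open ≤-Reasoning
  a≤ : a ≤ sum (map (a ⊔_) (n ∷ ns))
  a≤ = ≤-trans (m≤m⊔n a n) (m≤m+n (a ⊔ n) _)
  m≤ : m ≤ sum (map (a ⊔_) (n ∷ ns))
  m≤ = ≤-trans (≤-reflexive (trans (sym (+-identityʳ m)) eq)) (sum-map-⊔-≥ a (n ∷ ns))
sum-map-⊔-rebalance a ms@(_ ∷ _ ∷ _) ns eq _ large = begin
  sum (map (a ⊔_) ms)  ≡⟨ sum-map-⊔-≡ ms (large (s≤s (s≤s z≤n))) ⟩
  sum ms               ≡⟨ eq ⟩
  sum ns               ≤⟨ sum-map-⊔-≥ a ns ⟩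
  sum (map (a ⊔_) ns)  ∎
  where open ≤-Reasoning

2+m*k≤1+m*b : ∀ {k b} m → 2 * k ≤ b → suc (suc m) * k ≤ suc m * b
2+m*k≤1+m*b {k} {b} m 2k≤b = begin
  suc (suc m) * k  ≤⟨ *-monoˡ-≤ k (s≤s (s≤s (m≤m*n m 2))) ⟩
  suc m * 2 * k    ≡⟨ *-assoc (suc m) 2 k ⟩
  suc m * (2 * k)  ≤⟨ *-monoʳ-≤ (suc m) 2k≤b ⟩
  suc m * b        ∎
  where open ≤-Reasoning

-- If one part were shorter than k, balance would make all parts at most k long.
evenSplit-parts-≥ : ∀ {A : Set} {k b m} {xs : List A} {ps} → 2 * k ≤ b → suc m * b < length xs →
                    EvenSplit xs (suc (suc m)) ps → All (λ p → k ≤ length p) ps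
evenSplit-parts-≥ {k = k} {b} {m} {ps = ps} 2k≤b long (refl , |ps| , balanced) =
  All.tabulate λ p∈ps → ≮⇒≥ λ p<k → <⇒≱ long (short p∈ps p<k)
  where
  short : ∀ {p} → p ∈ ps → length p < k → length (concat ps) ≤ suc m * b
  short p∈ps p<k = begin
    length (concat ps)  ≤⟨ length-concat-≤ ps (All.tabulate λ q∈ps →
                             ≤-trans (All.lookup (All.lookup balanced q∈ps) p∈ps) p<k) ⟩
    length ps * k       ≡⟨ cong (_* k) |ps| ⟩
    suc (suc m) * k     ≤⟨ 2+m*k≤1+m*b {k} m 2k≤b ⟩
    suc m * b           ∎
    where open ≤-Reasoning

halves-≥ : ∀ {A : Set} {k b} {xs : List A} {ps qs} → 2 * k ≤ b → b < length xs →
           EvenSplit xs 2 (ps ∷ qs ∷ []) → k ≤ length ps × k ≤ length qs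
halves-≥ {k = k} {b} {xs} 2k≤b long even
  with evenSplit-parts-≥ {k = k} {m = 0} 2k≤b (subst (_< length xs) (sym (+-identityʳ b)) long) even
... | kp ∷ kq ∷ [] = kp , kq

ceilDiv-parts-≥ : ∀ {A : Set} {k b m} {xs : List A} {ps} → 2 * k ≤ b → IsCeilDiv (length xs) b m →
                  EvenSplit xs m ps → 2 ≤ length ps → All (λ p → k ≤ length p) ps
ceilDiv-parts-≥ {k = k} {b} {suc (suc m)} {xs} 2k≤b (_ , m*b<c+b) even _ =
  evenSplit-parts-≥ {k = k} 2k≤b
    (+-cancelʳ-< b (suc m * b) (length xs) (subst (_< length xs + b) (+-comm b (suc m * b)) m*b<c+b)) even
ceilDiv-parts-≥ {m = 0}     _ _ (_ , |ps| , _) two with subst (2 ≤_) |ps| two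
... | ()
ceilDiv-parts-≥ {m = 1}     _ _ (_ , |ps| , _) two with subst (2 ≤_) |ps| two
... | s≤s ()

length*b≤degrees+totalSlack : ∀ b ts → length ts * b ≤ sum (map degree ts) + totalSlack b ts
length*b≤degrees+totalSlack b []       = z≤n
length*b≤degrees+totalSlack b (t ∷ ts) = begin
  b + length ts * b                                    ≤⟨ +-mono-≤ (m≤n+m∸n b (degree t))
                                                            (length*b≤degrees+totalSlack b ts) ⟩
  (degree t + slack b t) + (degrees + totalSlack b ts)  ≡⟨ interchange (degree t) (slack b t) degrees _ ⟩
  (degree t + degrees) + (slack b t + totalSlack b ts)  ∎
  where
  open ≤-Reasoning
  degrees = sum (map degree ts)

m*b<degrees : ∀ b m ts → length ts ≡ suc m → totalSlack b ts < b → m * b < sum (map degree ts)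
m*b<degrees b m ts |ts| slack<b = +-cancelˡ-< b _ _ (begin-strict
  b + m * b                              ≡⟨ cong (_* b) (sym |ts|) ⟩
  length ts * b                          ≤⟨ length*b≤degrees+totalSlack b ts ⟩
  sum (map degree ts) + totalSlack b ts  <⟨ +-monoʳ-< (sum (map degree ts)) slack<b ⟩
  sum (map degree ts) + b                ≡⟨ +-comm _ b ⟩
  b + sum (map degree ts)                ∎)
  where open ≤-Reasoning

2*⌊n/2⌋≤n : ∀ n → 2 * ⌊ n /2⌋ ≤ n
2*⌊n/2⌋≤n n = begin
  ⌊ n /2⌋ + (⌊ n /2⌋ + 0)  ≡⟨ cong (⌊ n /2⌋ +_) (+-identityʳ ⌊ n /2⌋) ⟩
  ⌊ n /2⌋ + ⌊ n /2⌋        ≤⟨ +-monoʳ-≤ ⌊ n /2⌋ (⌊n/2⌋≤⌈n/2⌉ n) ⟩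
  ⌊ n /2⌋ + ⌈ n /2⌉        ≡⟨ ⌊n/2⌋+⌈n/2⌉≡n n ⟩
  n                        ∎
  where open ≤-Reasoning

NonEmpty : Tree → Set
NonEmpty (leaf _)    = ⊤
NonEmpty (node _ ts) = 1 ≤ length ts

Every-map : ∀ {P Q : Tree → Set} → (∀ {t} → P t → Q t) → ∀ {t} → Every P t → Every Q t
Every-map f E u u⊑t = f (E u u⊑t)

Every-children : ∀ {P w ts} → Every P (node w ts) → All (Every P) ts
Every-children E = All.tabulate λ c∈ts u u⊑c → E u (there u⊑c c∈ts)

⊑-trans : ∀ {v u t} → v ⊑ u → u ⊑ t → v ⊑ t
⊑-trans v⊑u here            = v⊑u
⊑-trans v⊑u (there u⊑c c∈ts) = there (⊑-trans v⊑u u⊑c) c∈ts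

leftmostWeight-uniform : ∀ {t s} → Every NonEmpty t → Uniform t s → leftmostWeight t ≡ s
leftmostWeight-uniform E leafU = refl
leftmostWeight-uniform {node w []} E (nodeU _) with E _ here
... | ()
leftmostWeight-uniform {node w (c ∷ _)} E (nodeU (uc ∷ _)) =
  cong (wt w +_) (leftmostWeight-uniform (All.head (Every-children E)) uc)

relaxedHeight-uniform : ∀ {t s} → Every NonEmpty t → Uniform t s → relaxedHeight t ≡ s ∸ 1
relaxedHeight-uniform E U = cong (_∸ 1) (leftmostWeight-uniform E U)

leftmostWeight-uniforms : ∀ {ts s} → All (Every NonEmpty) ts → All (λ c → Uniform c s) ts →
                          All (λ c → leftmostWeight c ≡ s) ts
leftmostWeight-uniforms Es Us = All.zipWith (λ (E , U) → leftmostWeight-uniform E U) (Es , Us)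

leftmostWeight-node : ∀ {w ts L} → 1 ≤ length ts → All (λ c → leftmostWeight c ≡ L) ts →
                      leftmostWeight (node w ts) ≡ wt w + L
leftmostWeight-node {w} {_ ∷ _} _ (lw≡ ∷ _) = cong (wt w +_) lw≡

leftmostWeight-pos : ∀ {t} → Every NonEmpty t → 1 ≤ leftmostWeight t
leftmostWeight-pos {leaf _}           E = s≤s z≤n
leftmostWeight-pos {node w1 (_ ∷ _)} E = s≤s z≤n
leftmostWeight-pos {node w0 (_ ∷ _)} E = leftmostWeight-pos (All.head (Every-children E))
leftmostWeight-pos {node w []}        E with E _ here
... | ()

uniform-⊑ : ∀ {u t s} → u ⊑ t → Uniform t s → ∃[ s' ] s' ≤ s × Uniform u s'
uniform-⊑ here U = _ , ≤-refl , U
uniform-⊑ (there {w = w} u⊑c c∈ts) (nodeU Us) with uniform-⊑ u⊑c (All.lookup Us c∈ts)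
... | s' , s'≤s , U' = s' , ≤-trans s'≤s (m≤n+m _ (wt w)) , U'

relaxedHeight-⊑ : ∀ {u t s} → Every NonEmpty t → Uniform t s → u ⊑ t →
                  relaxedHeight u ≤ relaxedHeight t
relaxedHeight-⊑ E U u⊑t with uniform-⊑ u⊑t U
... | s' , s'≤s , U' = ∸-monoˡ-≤ 1 (subst₂ _≤_ (sym (leftmostWeight-uniform E[u] U'))
                                                (sym (leftmostWeight-uniform E U)) s'≤s)
  where E[u] = λ v v⊑u → E v (⊑-trans v⊑u u⊑t)

children-uniform : ∀ {w ts s} → Uniform (node w ts) s → All (λ c → Uniform c (s ∸ wt w)) ts
children-uniform {w0} (nodeU Us) = Us
children-uniform {w1} (nodeU Us) = Us

All-replace : ∀ {A : Set} {P : A → Set} pre {z} ys post → (P z → All P ys) →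
              All P (pre ++ z ∷ post) → All P (pre ++ ys ++ post)
All-replace []        ys post f (pz ∷ ps) = All.++⁺ (f pz) ps
All-replace (a ∷ pre) ys post f (pa ∷ ps) = pa ∷ All-replace pre ys post f ps

numKeys-node : ∀ {w} ts → numKeys (node w ts) ≡ sum (map numKeys ts)
numKeys-node     []       = refl
numKeys-node {w} (t ∷ ts) = trans (length-++ (keysOf t)) (cong (numKeys t +_) (numKeys-node {w} ts))

floorBy : Wt → ℕ → ℕ → ℕ
floorBy w0 a n = n
floorBy w1 a n = a ⊔ n

floorBy-≥ : ∀ w a n → n ≤ floorBy w a n
floorBy-≥ w0 a n = ≤-refl
floorBy-≥ w1 a n = m≤n⊔m a n

floorBy-mono : ∀ w a {m n i} → m ≤ n + i → floorBy w a m ≤ floorBy w a n + i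
floorBy-mono w0 a m≤n+i = m≤n+i
floorBy-mono w1 a {m} {n} {i} m≤n+i =
  ⊔-lub (m≤n⇒m≤n+o i (m≤m⊔n a n)) (≤-trans m≤n+i (+-monoˡ-≤ i (m≤n⊔m a n)))

module Potential (k : ℕ) .{{_ : NonZero k}} where

  mutual
    value : Tree → ℕ
    value (leaf ks)     = 1 ⊔ length ks
    value t@(node w ts) = floorBy w (k ^ relaxedHeight t) (values ts)

    values : List Tree → ℕ
    values []       = 0
    values (t ∷ ts) = value t + values ts

  rootValue : Tree → ℕ
  rootValue (leaf ks)     = length ks
  rootValue t@(node w ts) = floorBy w (2 * k ^ (relaxedHeight t ∸ 1)) (values ts)

  values-++ : ∀ ts us → values (ts ++ us) ≡ values ts + values us
  values-++ []       us = refl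
  values-++ (t ∷ ts) us =
    trans (cong (value t +_) (values-++ ts us)) (sym (+-assoc (value t) (values ts) (values us)))

  values-concat : ∀ tss → values (concat tss) ≡ sum (map values tss)
  values-concat []         = refl
  values-concat (ts ∷ tss) = trans (values-++ ts (concat tss)) (cong (values ts +_) (values-concat tss))

  1≤k : 1 ≤ k
  1≤k = >-nonZero⁻¹ k

  k^h≤k*k^[h∸1] : ∀ h → k ^ h ≤ k * k ^ (h ∸ 1)
  k^h≤k*k^[h∸1] zero    = ≤-trans 1≤k (m≤m*n k 1)
  k^h≤k*k^[h∸1] (suc h) = ≤-refl

  value-≥ : ∀ {t} → Every NonEmpty t → k ^ relaxedHeight t ≤ value t
  value-≥ {leaf ks}          E = m≤m⊔n 1 (length ks)
  value-≥ {node w1 ts}       E = m≤m⊔n _ (values ts)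
  value-≥ {node w0 (c ∷ ts)} E =
    ≤-trans (value-≥ (All.head (Every-children E))) (m≤m+n (value c) (values ts))
  value-≥ {node w0 []}       E with E _ here
  ... | ()

  values-≥ : ∀ {L ts} → All (Every NonEmpty) ts → All (λ c → leftmostWeight c ≡ L) ts →
             length ts * k ^ (L ∸ 1) ≤ values ts
  values-≥ []       []            = z≤n
  values-≥ (E ∷ Es) (refl ∷ lw≡s) = +-mono-≤ (value-≥ E) (values-≥ Es lw≡s)

  value-node₁ : ∀ {L p} → 1 ≤ length p → All (λ c → leftmostWeight c ≡ L) p →
                value (node w1 p) ≡ k ^ L ⊔ values p
  value-node₁ {p = p} nonEmpty lw≡ =
    cong (λ l → k ^ (l ∸ 1) ⊔ values p) (leftmostWeight-node nonEmpty lw≡)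

  wide-values-≥ : ∀ {L p} → k ≤ length p → All (Every NonEmpty) p →
                  All (λ c → leftmostWeight c ≡ L) p → k ^ L ≤ values p
  wide-values-≥ {L} {p} k≤p Es lw≡ = begin
    k ^ L                    ≤⟨ k^h≤k*k^[h∸1] L ⟩
    k * k ^ (L ∸ 1)          ≤⟨ *-monoˡ-≤ (k ^ (L ∸ 1)) k≤p ⟩
    length p * k ^ (L ∸ 1)   ≤⟨ values-≥ Es lw≡ ⟩
    values p                 ∎
    where open ≤-Reasoning

  value-node₁-wide : ∀ {L p} → k ≤ length p → All (Every NonEmpty) p →
                     All (λ c → leftmostWeight c ≡ L) p → value (node w1 p) ≡ values p
  value-node₁-wide k≤p Es lw≡ =
    trans (value-node₁ (≤-trans 1≤k k≤p) lw≡)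
          (m≤n⇒m⊔n≡n (wide-values-≥ k≤p Es lw≡))

  values-nodes₁ : ∀ {L} ps → All (λ p → 1 ≤ length p) ps →
                  All (All (λ c → leftmostWeight c ≡ L)) ps →
                  values (map (node w1) ps) ≡ sum (map (k ^ L ⊔_) (map values ps))
  values-nodes₁ []       []                   []              = refl
  values-nodes₁ (p ∷ ps) (nonEmpty ∷ nonEmpties) (lw≡ ∷ lws≡) =
    cong₂ _+_ (value-node₁ nonEmpty lw≡) (values-nodes₁ ps nonEmpties lws≡)

  values-leaves : ∀ kss → values (map leaf kss) ≡ sum (map (1 ⊔_) (map length kss))
  values-leaves []         = refl
  values-leaves (ks ∷ kss) = cong (1 ⊔ length ks +_) (values-leaves kss)

  record Growth≤ (i : ℕ) (t t' : Tree) : Set where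
    field
      leftmostWeight-≡ : leftmostWeight t' ≡ leftmostWeight t
      value-≤          : value t' ≤ value t + i
      rootValue-≤      : rootValue t' ≤ rootValue t + i
  open Growth≤ public

  node-growth : ∀ {i} w ts ts' → leftmostWeight (node w ts') ≡ leftmostWeight (node w ts) →
                values ts' ≤ values ts + i → Growth≤ i (node w ts) (node w ts')
  node-growth w ts ts' lw≡ _     .leftmostWeight-≡ = lw≡
  node-growth w ts ts' lw≡ vs≤ .value-≤     rewrite lw≡ = floorBy-mono w _ vs≤
  node-growth w ts ts' lw≡ vs≤ .rootValue-≤ rewrite lw≡ = floorBy-mono w _ vs≤

  leaf-growth : ∀ {i ks ks'} → length ks' ≤ length ks + i → Growth≤ i (leaf ks) (leaf ks')
  leaf-growth _ .leftmostWeight-≡ = refl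
  leaf-growth {i} {ks} ks'≤ .value-≤ =
    ⊔-lub (m≤n⇒m≤n+o i (m≤m⊔n 1 (length ks)))
          (≤-trans ks'≤ (+-monoˡ-≤ i (m≤n⊔m 1 (length ks))))
  leaf-growth ks'≤ .rootValue-≤ = ks'≤

  Growth≤-trans : ∀ {i j t t' t''} → Growth≤ i t t' → Growth≤ j t' t'' → Growth≤ (i + j) t t''
  Growth≤-trans g g' .leftmostWeight-≡ = trans (leftmostWeight-≡ g') (leftmostWeight-≡ g)
  Growth≤-trans {i} {j} {t} g g' .value-≤ =
    ≤-trans (value-≤ g')
            (≤-trans (+-monoˡ-≤ j (value-≤ g)) (≤-reflexive (+-assoc (value t) i j)))
  Growth≤-trans {i} {j} {t} g g' .rootValue-≤ =
    ≤-trans (rootValue-≤ g')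
            (≤-trans (+-monoˡ-≤ j (rootValue-≤ g)) (≤-reflexive (+-assoc (rootValue t) i j)))

  values-replace-≤ : ∀ {i c c'} pre post → value c' ≤ value c + i →
                     values (pre ++ c' ∷ post) ≤ values (pre ++ c ∷ post) + i
  values-replace-≤ {i} {c} [] post c'≤ =
    ≤-trans (+-monoˡ-≤ (values post) c'≤) (≤-reflexive (xy∙z≈xz∙y (value c) i (values post)))
  values-replace-≤ {i} (t ∷ pre) post c'≤ =
    ≤-trans (+-monoʳ-≤ (value t) (values-replace-≤ pre post c'≤))
            (≤-reflexive (sym (+-assoc (value t) _ i)))

  replace-child-growth : ∀ {i c c'} w pre post → Growth≤ i c c' →
                         Growth≤ i (node w (pre ++ c ∷ post)) (node w (pre ++ c' ∷ post))
  replace-child-growth w pre post g = node-growth w _ _ (lw≡ pre) (values-replace-≤ pre post (value-≤ g))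
    where
    lw≡ : ∀ pre → leftmostWeight (node w (pre ++ _ ∷ post)) ≡ leftmostWeight (node w (pre ++ _ ∷ post))
    lw≡ []      = cong (wt w +_) (leftmostWeight-≡ g)
    lw≡ (_ ∷ _) = refl

  values-absorb : ∀ pre x y post →
                  values (pre ++ x ∷ y ∷ post) ≡ values (pre ++ node w0 (x ∷ y ∷ []) ∷ post)
  values-absorb []        x y post =
    trans (cong (λ n → value x + (n + values post)) (sym (+-identityʳ (value y))))
          (sym (+-assoc (value x) (value y + 0) (values post)))
  values-absorb (t ∷ pre) x y post = cong (value t +_) (values-absorb pre x y post)

  absorb-growth : ∀ w pre x y post →
                  Growth≤ 0 (node w (pre ++ node w0 (x ∷ y ∷ []) ∷ post)) (node w (pre ++ x ∷ y ∷ post))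
  absorb-growth w pre x y post =
    node-growth w _ _ (lw≡ pre) (m≤n⇒m≤n+o 0 (≤-reflexive (values-absorb pre x y post)))
    where
    lw≡ : ∀ pre → leftmostWeight (node w (pre ++ x ∷ y ∷ post))
                ≡ leftmostWeight (node w (pre ++ node w0 (x ∷ y ∷ []) ∷ post))
    lw≡ []      = refl
    lw≡ (_ ∷ _) = refl

  regroupLeaves-growth : ∀ kss ps → concat ps ≡ concat kss → 1 ≤ length kss → 1 ≤ length ps →
                         (2 ≤ length ps → All (λ p → 1 ≤ length p) ps) →
                         Growth≤ 0 (node w1 (map leaf kss)) (node w1 (map leaf ps))
  regroupLeaves-growth kss@(_ ∷ _) ps@(_ ∷ _) same _ _ parts-nonEmpty =
    node-growth w1 _ _ refl (m≤n⇒m≤n+o 0 (begin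
      values (map leaf ps)               ≡⟨ values-leaves ps ⟩
      sum (map (1 ⊔_) (map length ps))   ≤⟨ sum-map-⊔-rebalance 1 (map length ps) (map length kss)
                                              lengths≡ (s≤s z≤n) nonEmpty-lengths ⟩
      sum (map (1 ⊔_) (map length kss))  ≡⟨ values-leaves kss ⟨
      values (map leaf kss)              ∎))
    where
    open ≤-Reasoning
    nonEmpty-lengths : 2 ≤ length (map length ps) → All (1 ≤_) (map length ps)
    nonEmpty-lengths two = All.map⁺ (parts-nonEmpty (subst (2 ≤_) (length-map length ps) two))
    lengths≡ : sum (map length ps) ≡ sum (map length kss)
    lengths≡ = trans (sym (length-concat ps)) (trans (cong length same) (length-concat kss))

  leftmostWeight-nodes₁ : ∀ {L ps} → 1 ≤ length ps → All (λ p → 1 ≤ length p) ps →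
                          All (All (λ c → leftmostWeight c ≡ L)) ps →
                          leftmostWeight (node w1 (map (node w1) ps)) ≡ 2 + L
  leftmostWeight-nodes₁ {ps = _ ∷ _} _ (nonEmpty ∷ _) (lw≡ ∷ _) =
    cong suc (leftmostWeight-node nonEmpty lw≡)

  -- Either a single child remains, or every child gets at least k grandchildren of equal height and
  -- is then worth exactly its grandchildren, so its floor k^h costs nothing.
  regroup-growth : ∀ {s} tss ps → concat ps ≡ concat tss →
                   Every NonEmpty (node w1 (map (node w1) tss)) → Uniform (node w1 (map (node w1) tss)) s →
                   Every NonEmpty (node w1 (map (node w1) ps)) →
                   (2 ≤ length ps → All (λ p → k ≤ length p) ps) →
                   Growth≤ 0 (node w1 (map (node w1) tss)) (node w1 (map (node w1) ps))
  regroup-growth {suc s} tss ps same E (nodeU Us) E' wide =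
    node-growth w1 _ _ lw≡ (m≤n⇒m≤n+o 0 (begin
      values (map (node w1) ps)                    ≡⟨ values-nodes₁ ps (parts E') (regrouped grand-lw) ⟩
      sum (map (k ^ (s ∸ 1) ⊔_) (map values ps))   ≤⟨ sum-map-⊔-rebalance _ (map values ps) (map values tss)
                                                        sums≡ tss≢[] wide-values ⟩
      sum (map (k ^ (s ∸ 1) ⊔_) (map values tss))  ≡⟨ values-nodes₁ tss (parts E) (All.concat⁻ grand-lw) ⟨
      values (map (node w1) tss)                   ∎))
    where
    open ≤-Reasoning
    grand-E : All (Every NonEmpty) (concat tss)
    grand-E = All.concat⁺ (All.map Every-children (All.map⁻ (Every-children E)))
    grand-lw : All (λ c → leftmostWeight c ≡ s ∸ 1) (concat tss)
    grand-lw = leftmostWeight-uniforms grand-E (All.concat⁺ (All.map children-uniform (All.map⁻ Us)))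
    regrouped : ∀ {P : Tree → Set} → All P (concat tss) → All (All P) ps
    regrouped A = All.concat⁻ (subst (All _) (sym same) A)
    parts : ∀ {qs} → Every NonEmpty (node w1 (map (node w1) qs)) → All (λ q → 1 ≤ length q) qs
    parts E = All.map (λ Eq → Eq _ here) (All.map⁻ (Every-children E))
    nonEmpty : ∀ {qs} → Every NonEmpty (node w1 (map (node w1) qs)) → 1 ≤ length qs
    nonEmpty {qs} E = subst (1 ≤_) (length-map (node w1) qs) (E _ here)
    lw≡ : leftmostWeight (node w1 (map (node w1) ps)) ≡ leftmostWeight (node w1 (map (node w1) tss))
    lw≡ = trans (leftmostWeight-nodes₁ (nonEmpty E') (parts E') (regrouped grand-lw))
                (sym (leftmostWeight-nodes₁ (nonEmpty E) (parts E) (All.concat⁻ grand-lw)))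
    tss≢[] : 1 ≤ length (map values tss)
    tss≢[] = subst (1 ≤_) (sym (length-map values tss)) (nonEmpty E)
    sums≡ : sum (map values ps) ≡ sum (map values tss)
    sums≡ = trans (sym (values-concat ps)) (trans (cong values same) (values-concat tss))
    wide-values : 2 ≤ length (map values ps) → All (k ^ (s ∸ 1) ≤_) (map values ps)
    wide-values two = All.map⁺ (All.zipWith (λ (k≤p , Es , lw≡) → wide-values-≥ k≤p Es lw≡)
      (wide (subst (2 ≤_) (length-map values ps) two) , All.zip (regrouped grand-E , regrouped grand-lw)))

module Rebalancing (b k : ℕ) (2≤k : 2 ≤ k) (2k≤b : 2 * k ≤ b) where

  instance
    k≢0 : NonZero k
    k≢0 = >-nonZero (≤-trans (s≤s z≤n) 2≤k)

  open Potential k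

  4≤b : 4 ≤ b
  4≤b = ≤-trans (*-monoʳ-≤ 2 2≤k) 2k≤b

  b≢2 : b ≢ 2
  b≢2 refl with 4≤b
  ... | s≤s (s≤s ())

  ≤b∸1⇒<b : ∀ {m} → m ≤ b ∸ 1 → m < b
  ≤b∸1⇒<b m≤ = ≤-<-trans m≤ (∸-monoʳ-< {o = 0} (s≤s z≤n) (≤-trans (s≤s z≤n) 4≤b))

  2*k^[h∸1]≤k^h : ∀ {h} → 1 ≤ h → 2 * k ^ (h ∸ 1) ≤ k ^ h
  2*k^[h∸1]≤k^h {suc h} _ = *-monoˡ-≤ (k ^ h) 2≤k

  Relaxed : Tree → Set
  Relaxed = RelaxedNodeOK b

  relaxed-nonEmpty : ∀ {t} → Relaxed t → NonEmpty t
  relaxed-nonEmpty {leaf _}   _        = tt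
  relaxed-nonEmpty {node _ _} (1≤ , _) = 1≤

  nonEmpty : ∀ {t} → Every Relaxed t → Every NonEmpty t
  nonEmpty = Every-map relaxed-nonEmpty

  overflow-growth : ∀ {ks xs ps qs} → length ks ≡ b → length xs ≡ suc (length ks) →
                    EvenSplit xs 2 (ps ∷ qs ∷ []) → Growth≤ 1 (leaf ks) (node w0 (leaf ps ∷ leaf qs ∷ []))
  overflow-growth {ks} {xs} {ps} {qs} full |xs| even@(same , _) = record
    { leftmostWeight-≡ = refl
    ; value-≤          = ≤-trans (≤-reflexive values≡) (+-monoˡ-≤ 1 (m≤n⊔m 1 (length ks)))
    ; rootValue-≤      = ≤-reflexive values≡
    }
    where
    halves = halves-≥ 2k≤b (subst (_< length xs) full (≤-reflexive (sym |xs|))) even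
    values≡ : values (leaf ps ∷ leaf qs ∷ []) ≡ length ks + 1
    values≡ = begin
      1 ⊔ length ps + (1 ⊔ length qs + 0)  ≡⟨ cong₂ (λ m n → m + (n + 0))
                                                (m≤n⇒m⊔n≡n (≤-trans 1≤k (proj₁ halves)))
                                                (m≤n⇒m⊔n≡n (≤-trans 1≤k (proj₂ halves))) ⟩
      length ps + (length qs + 0)          ≡⟨ sym (length-concat (ps ∷ qs ∷ [])) ⟩
      length (concat (ps ∷ qs ∷ []))       ≡⟨ cong length same ⟩
      length xs                            ≡⟨ |xs| ⟩
      suc (length ks)                      ≡⟨ +-comm 1 (length ks) ⟩
      length ks + 1                        ∎
      where open ≡-Reasoning

  halve-growth : ∀ {s ts ps qs} → b < length ts → EvenSplit ts 2 (ps ∷ qs ∷ []) →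
                 All (Every NonEmpty) ts → All (λ c → Uniform c s) ts →
                 Growth≤ 0 (node w1 ts) (node w0 (node w1 ps ∷ node w1 qs ∷ []))
  halve-growth {ps = ps} {qs} long even@(refl , _) Es Us = record
    { leftmostWeight-≡ = trans (leftmostWeight-node 1≤ps (proj₁ lws))
                               (sym (leftmostWeight-node (≤-trans (s≤s z≤n) long) lw≡))
    ; value-≤          = m≤n⇒m≤n+o 0 (≤-trans (≤-reflexive values≡) (m≤n⊔m _ _))
    ; rootValue-≤      = m≤n⇒m≤n+o 0 (≤-trans (≤-reflexive values≡) (m≤n⊔m _ _))
    }
    where
    halves = halves-≥ 2k≤b long even
    1≤ps = ≤-trans 1≤k (proj₁ halves)
    lw≡ = leftmostWeight-uniforms Es Us
    split-All : ∀ {P : Tree → Set} → All P (ps ++ qs ++ []) → All P ps × All P qs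
    split-All A = proj₁ (All.++⁻ ps A) , All.++⁻ˡ qs (proj₂ (All.++⁻ ps A))
    lws = split-All lw≡
    Ess = split-All Es
    values≡ : values (node w1 ps ∷ node w1 qs ∷ []) ≡ values (ps ++ qs ++ [])
    values≡ = begin
      value (node w1 ps) + (value (node w1 qs) + 0)
        ≡⟨ cong₂ (λ m n → m + (n + 0)) (value-node₁-wide (proj₁ halves) (proj₁ Ess) (proj₁ lws))
                                       (value-node₁-wide (proj₂ halves) (proj₂ Ess) (proj₂ lws)) ⟩
      values ps + (values qs + 0)
        ≡⟨ cong (values ps +_) (sym (values-++ qs [])) ⟩
      values ps + values (qs ++ [])
        ≡⟨ sym (values-++ ps (qs ++ [])) ⟩
      values (ps ++ qs ++ [])
        ∎
      where open ≡-Reasoning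

  oneChild-parts-≥ : ∀ {tss ps} → 2 ≤ length tss → totalSlack b (map (node w1) tss) < b →
                     EvenSplit (concat tss) (length tss) ps → All (λ p → k ≤ length p) ps
  oneChild-parts-≥ {_ ∷ []} (s≤s ()) _ _
  oneChild-parts-≥ {tss@(_ ∷ _ ∷ _)} _ slack<b even =
    evenSplit-parts-≥ 2k≤b
      (subst (_ <_) degrees≡ (m*b<degrees b _ (map (node w1) tss) (length-map _ tss) slack<b)) even
    where
    degrees≡ : sum (map degree (map (node w1) tss)) ≡ length (concat tss)
    degrees≡ = trans (cong sum (sym (map-∘ {g = degree} {f = node w1} tss))) (sym (length-concat tss))

  local-growth : ∀ {ins t t' s} → Local b ins t t' → Every Relaxed t → Uniform t s → Every Relaxed t' →
                 Growth≤ (ifIns ins) t t'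
  local-growth (delete pre x post) _ _ _ =
    leaf-growth (m≤n⇒m≤n+o 0 (≤-trans (n≤1+n _) (≤-reflexive (sym (length-++-sucʳ pre x post)))))
  local-growth (insertSimple pre x post _) _ _ _ =
    leaf-growth (≤-reflexive (trans (length-++-sucʳ pre x post) (+-comm 1 _)))
  local-growth (insertSplit pre x post ps qs full even) _ _ _ =
    overflow-growth full (length-++-sucʳ pre x post) even
  local-growth (absorb w pre x y post _) _ _ _ = absorb-growth w pre x y post
  local-growth (split w0 pre x y post ps qs full even) E _ _ =
    ⊥-elim (b≢2 (trans (sym full) (proj₂ (proj₂ (E _ here)) refl)))
  local-growth (split w1 pre x y post ps qs full even) E (nodeU Us) _ =
    Growth≤-trans (absorb-growth w1 pre x y post)
      (halve-growth long even
        (All-replace pre (x ∷ y ∷ []) post Every-children (Every-children (nonEmpty E)))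
        (All-replace pre (x ∷ y ∷ []) post children-uniform Us))
    where
    long : b < length (pre ++ x ∷ y ∷ post)
    long = begin-strict
      b                                      ≡⟨ sym full ⟩
      length (pre ++ node w0 (x ∷ y ∷ []) ∷ post)  ≡⟨ length-++-sucʳ pre _ post ⟩
      suc (length (pre ++ post))             <⟨ n<1+n _ ⟩
      suc (suc (length (pre ++ post)))       ≡⟨ cong suc (length-++-sucʳ pre y post) ⟨
      suc (length (pre ++ y ∷ post))         ≡⟨ length-++-sucʳ pre x (y ∷ post) ⟨
      length (pre ++ x ∷ y ∷ post)           ∎
      where open ≤-Reasoning
  local-growth (compressLeaves kss m ps two _ ceil even) _ _ E' =
    regroupLeaves-growth kss ps (proj₁ even) (≤-trans (s≤s z≤n) two)
      (subst (1 ≤_) (length-map leaf ps) (proj₁ (E' _ here)))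
      (λ two' → All.map (≤-trans 1≤k) (ceilDiv-parts-≥ 2k≤b ceil even two'))
  local-growth (compressNodes tss m ps _ _ ceil even) E U E' =
    regroup-growth tss ps (proj₁ even) (nonEmpty E) U (nonEmpty E') (ceilDiv-parts-≥ 2k≤b ceil even)
  local-growth (oneChild tss ps _ two slack<b even) E U E' =
    regroup-growth tss ps (proj₁ even) (nonEmpty E) U (nonEmpty E')
      (λ _ → oneChild-parts-≥ {tss} two slack<b even)

  deep-growth : ∀ {ins t t' s} → Deep b ins t t' → Every Relaxed t → Uniform t s → Every Relaxed t' →
                Growth≤ (ifIns ins) t t'
  deep-growth (atNode l) = local-growth l
  deep-growth (inside {w = w} {pre} {post = post} d) E (nodeU Us) E' =
    replace-child-growth w pre post
      (deep-growth d (child (Every-children E)) (child Us) (child (Every-children E')))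
    where
    child : ∀ {P : Tree → Set} {c} → All P (pre ++ c ∷ post) → P c
    child A = All.lookup A (∈-++⁺ʳ pre (here refl))

  weightZero-values-≥ : ∀ {ts s} → Every Relaxed (node w0 ts) → Uniform (node w0 ts) s →
                        2 * k ^ relaxedHeight (node w0 ts) ≤ values ts
  weightZero-values-≥ {[]} E _ with E _ here
  ... | ()
  weightZero-values-≥ {_ ∷ []} E _ with proj₂ (proj₂ (E _ here)) refl
  ... | ()
  weightZero-values-≥ {_ ∷ _ ∷ _ ∷ _} E _ with proj₂ (proj₂ (E _ here)) refl
  ... | ()
  weightZero-values-≥ {ts@(_ ∷ _ ∷ [])} E U@(nodeU Us) =
    subst (λ h → 2 * k ^ h ≤ values ts) (sym (relaxedHeight-uniform (nonEmpty E) U))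
          (values-≥ Es (leftmostWeight-uniforms Es Us))
    where Es = Every-children (nonEmpty E)

  -- A weight-zero node promoted to the root gains a level, and its two children meet the new floor.
  promote-rootValue : ∀ {ts s} → Every Relaxed (node w0 ts) → Uniform (node w0 ts) s →
                      rootValue (node w1 ts) ≤ values ts
  promote-rootValue {[]}    E _ with E _ here
  ... | ()
  promote-rootValue {_ ∷ _} E U = ⊔-lub (weightZero-values-≥ E U) ≤-refl

  child-≤-rootValue : ∀ w c → value c ≤ rootValue (node w (c ∷ []))
  child-≤-rootValue w c = ≤-trans (m≤m+n (value c) 0) (floorBy-≥ w _ _)

  root-rootValue : ∀ {t t'} → RootStep t t' → RelaxedBSlack b t → RelaxedBSlack b t' →
                   rootValue t' ≤ rootValue t
  root-rootValue (rootReplaceLeaf w ks) _ _ = ≤-trans (m≤n⊔m 1 (length ks)) (child-≤-rootValue w (leaf ks))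
  root-rootValue (rootReplaceNode w w1 []) _ (E' , _) with E' _ here
  ... | ()
  root-rootValue (rootReplaceNode w w1 ts@(_ ∷ _)) _ (E' , _) =
    ≤-trans (⊔-monoˡ-≤ (values ts) (2*k^[h∸1]≤k^h 1≤h)) (child-≤-rootValue w (node w1 ts))
    where
    1≤h = leftmostWeight-pos (All.head (Every-children (nonEmpty E')))
  root-rootValue (rootReplaceNode w w0 ts) (E , _ , nodeU (U ∷ [])) _ =
    ≤-trans (promote-rootValue (All.head (Every-children E)) U) (child-≤-rootValue w (node w0 ts))
  root-rootValue (rootZero ts _) (E , _ , U) _ = promote-rootValue E U

  step-rootValue : ∀ {ins t t'} → Step b ins t t' → RelaxedBSlack b t → RelaxedBSlack b t' →
                   rootValue t' ≤ rootValue t + ifIns ins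
  step-rootValue (deep d) (E , _ , U) (E' , _) = rootValue-≤ (deep-growth d E U E')
  step-rootValue (root r) R R'                 = m≤n⇒m≤n+o 0 (root-rootValue r R R')

  reach-start-relaxed : ∀ {t i T} → Reach b t i T → RelaxedBSlack b T → RelaxedBSlack b t
  reach-start-relaxed done         R = R
  reach-start-relaxed (step R _ _) _ = R

  reach-rootValue : ∀ {t i T} → Reach b t i T → RelaxedBSlack b T → rootValue T ≤ rootValue t + i
  reach-rootValue done _ = m≤n⇒m≤n+o 0 ≤-refl
  reach-rootValue {t} {T = T} (step {ins = ins} {t'} {i} R st rest) R-T = begin
    rootValue T                  ≤⟨ reach-rootValue rest R-T ⟩
    rootValue t' + i             ≤⟨ +-monoˡ-≤ i (step-rootValue st R (reach-start-relaxed rest R-T)) ⟩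
    rootValue t + ifIns ins + i  ≡⟨ +-assoc (rootValue t) (ifIns ins) i ⟩
    rootValue t + (ifIns ins + i)  ∎
    where open ≤-Reasoning

  rootValue-≥ : ∀ {T} → RelaxedBSlack b T → 1 ≤ relaxedHeight T →
                2 * k ^ (relaxedHeight T ∸ 1) ≤ rootValue T
  rootValue-≥ {node w1 ts} _           _ = m≤m⊔n _ (values ts)
  rootValue-≥ {node w0 ts} (E , _ , U) _ =
    ≤-trans (*-monoʳ-≤ 2 (^-monoʳ-≤ k (m∸n≤m (relaxedHeight (node w0 ts)) 1))) (weightZero-values-≥ E U)

  BNode : Tree → Set
  BNode = BSlackNodeOK b

  bslack-nonEmpty : ∀ {t} → BNode t → NonEmpty t
  bslack-nonEmpty {leaf _}   _            = tt
  bslack-nonEmpty {node _ _} (_ , 2≤ , _) = ≤-trans (s≤s z≤n) 2≤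

  degrees-≥ : ∀ ts → 2 ≤ length ts → totalSlack b ts ≤ b ∸ 1 → length ts * k ≤ sum (map degree ts)
  degrees-≥ (_ ∷ [])           (s≤s ()) _
  degrees-≥ ts@(_ ∷ _ ∷ rest) _        slack≤ =
    ≤-trans (2+m*k≤1+m*b {k} (length rest) 2k≤b)
            (<⇒≤ (m*b<degrees b (suc (length rest)) ts refl (≤b∸1⇒<b slack≤)))

  degrees-pos : ∀ ts → totalSlack b ts ≤ b ∸ 1 → All (λ c → 1 ≤ degree c) ts
  degrees-pos []       _      = []
  degrees-pos (t ∷ ts) slack≤ =
    pos (degree t) (≤b∸1⇒<b (m+n≤o⇒m≤o (slack b t) slack≤))
      ∷ degrees-pos ts (m+n≤o⇒n≤o (slack b t) slack≤)
    where
    pos : ∀ d → b ∸ d < b → 1 ≤ d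
    pos zero    b<b = ⊥-elim (n≮n b b<b)
    pos (suc d) _   = s≤s z≤n

  -- The slack condition gives the children of a B-slack node at least k pointers or keys on average.
  mutual
    keys-≥ : ∀ {t s} → Every BNode t → Uniform t s → degree t * k ^ (s ∸ 1) ≤ numKeys t
    keys-≥ {leaf ks}   _ leafU = ≤-reflexive (*-identityʳ (length ks))
    keys-≥ {node w ts} E (nodeU {s = s} Us) with E _ here
    ... | refl , two , _ , slack≤ = begin
      length ts * k ^ s                  ≤⟨ *-monoʳ-≤ (length ts) (k^h≤k*k^[h∸1] s) ⟩
      length ts * (k * k ^ (s ∸ 1))      ≡⟨ *-assoc (length ts) k _ ⟨
      length ts * k * k ^ (s ∸ 1)        ≤⟨ *-monoˡ-≤ (k ^ (s ∸ 1)) (degrees-≥ ts two slack≤) ⟩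
      sum (map degree ts) * k ^ (s ∸ 1)  ≤⟨ keys-≥-all (Every-children E) Us ⟩
      sum (map numKeys ts)               ≡⟨ numKeys-node {w1} ts ⟨
      numKeys (node w1 ts)               ∎
      where open ≤-Reasoning

    keys-≥-all : ∀ {ts s} → All (Every BNode) ts → All (λ c → Uniform c s) ts →
                 sum (map degree ts) * k ^ (s ∸ 1) ≤ sum (map numKeys ts)
    keys-≥-all             []       []       = z≤n
    keys-≥-all {t ∷ _} {s} (E ∷ Es) (U ∷ Us) =
      ≤-trans (≤-reflexive (*-distribʳ-+ (k ^ (s ∸ 1)) (degree t) _))
              (+-mono-≤ (keys-≥ E U) (keys-≥-all Es Us))

  node-keys-≥ : ∀ {ts s} → Every BNode (node w1 ts) → Uniform (node w1 ts) s →
                length ts * k ^ relaxedHeight (node w1 ts) ≤ numKeys (node w1 ts)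
  node-keys-≥ {ts} E U =
    subst (λ h → length ts * k ^ h ≤ numKeys (node w1 ts))
          (sym (relaxedHeight-uniform (Every-map bslack-nonEmpty E) U)) (keys-≥ E U)

  mutual
    value-≤-numKeys : ∀ {t s} → Every BNode t → Uniform t s → 1 ≤ degree t → value t ≤ numKeys t
    value-≤-numKeys {leaf ks}   _ leafU 1≤ = ⊔-lub 1≤ ≤-refl
    value-≤-numKeys {node w ts} E U     1≤ with E _ here
    ... | refl , _ = ⊔-lub (begin
      k ^ h                 ≡⟨ *-identityˡ (k ^ h) ⟨
      1 * k ^ h             ≤⟨ *-monoˡ-≤ (k ^ h) 1≤ ⟩
      length ts * k ^ h     ≤⟨ node-keys-≥ E U ⟩
      numKeys (node w1 ts)  ∎) (children-values-≤-numKeys E U)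
      where
      open ≤-Reasoning
      h = relaxedHeight (node w1 ts)

    children-values-≤-numKeys : ∀ {ts s} → Every BNode (node w1 ts) → Uniform (node w1 ts) s →
                                values ts ≤ numKeys (node w1 ts)
    children-values-≤-numKeys {ts} E (nodeU Us) =
      ≤-trans (values-≤-numKeys (Every-children E) Us (degrees-pos ts slack≤))
              (≤-reflexive (sym (numKeys-node {w1} ts)))
      where slack≤ = proj₂ (proj₂ (proj₂ (E _ here)))

    values-≤-numKeys : ∀ {ts s} → All (Every BNode) ts → All (λ c → Uniform c s) ts →
                       All (λ c → 1 ≤ degree c) ts → values ts ≤ sum (map numKeys ts)
    values-≤-numKeys []       []       []         = z≤n
    values-≤-numKeys (E ∷ Es) (U ∷ Us) (1≤ ∷ 1≤s) =
      +-mono-≤ (value-≤-numKeys E U 1≤) (values-≤-numKeys Es Us 1≤s)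

  rootValue-≤-numKeys : ∀ {T} → BSlack b T → rootValue T ≤ numKeys T
  rootValue-≤-numKeys {leaf ks}   _           = ≤-refl
  rootValue-≤-numKeys {node w ts} (E , _ , U) with E _ here
  ... | refl , two , _ = ⊔-lub (begin
    2 * k ^ (h ∸ 1)        ≤⟨ *-mono-≤ two (^-monoʳ-≤ k (m∸n≤m h 1)) ⟩
    length ts * k ^ h      ≤⟨ node-keys-≥ E U ⟩
    numKeys (node w1 ts)   ∎) (children-values-≤-numKeys E U)
    where
    open ≤-Reasoning
    h = relaxedHeight (node w1 ts)

  height-bound : ∀ {i T₀ T u} → BSlack b T₀ → Reach b T₀ i T → RelaxedBSlack b T → u ⊑ T →
                 1 ≤ relaxedHeight u → 2 * k ^ (relaxedHeight u ∸ 1) ≤ numKeys T₀ + i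
  height-bound {i} {T₀} {T} {u} B₀ R R-T@(E , _ , U) u⊑T 1≤h = begin
    2 * k ^ (relaxedHeight u ∸ 1)  ≤⟨ *-monoʳ-≤ 2 (^-monoʳ-≤ k (∸-monoˡ-≤ 1 u≤T)) ⟩
    2 * k ^ (relaxedHeight T ∸ 1)  ≤⟨ rootValue-≥ R-T (≤-trans 1≤h u≤T) ⟩
    rootValue T                    ≤⟨ reach-rootValue R R-T ⟩
    rootValue T₀ + i               ≤⟨ +-monoˡ-≤ i (rootValue-≤-numKeys B₀) ⟩
    numKeys T₀ + i                 ∎
    where
    open ≤-Reasoning
    u≤T = relaxedHeight-⊑ (nonEmpty E) U u⊑T

corollary22 : (b : ℕ) → 4 < b →
    (n i : ℕ) (T₀ T : Tree) →
    BSlack b T₀ → numKeys T₀ ≡ n →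
    Reach b T₀ i T → RelaxedBSlack b T →
    (u : Tree) → u ⊑ T → HeightBound ⌊ b /2⌋ (n + i) (relaxedHeight u)
corollary22 b 4<b n i T₀ T B₀ refl R R-T u u⊑T =
  Rebalancing.height-bound b ⌊ b /2⌋ (⌊n/2⌋-mono (<⇒≤ 4<b)) (2*⌊n/2⌋≤n b) B₀ R R-T u⊑T
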